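{- Let $p=(p_1,\dots,p_t)$ be a sequence of positive integers, $t\ge1$, and $d_t=\sum_{i=1}^t p_i+t$. Then, as polynomials in $n$ (in particular for every nonnegative integer $n$), $$F_{p}(-n) = (-1)^{d_t}\sum_{p\prec q} F_q(n+1),$$ where the sum is over all sequences $q$ of positive integers coarsening $p$.
   Context: For a sequence $p_1,\dots,p_t$ of positive integers and $n\in\mathbb{N}$, $F_{p_1,\dots,p_t}(n)=\sum_{0\le k_1<\dots<k_t\le n-1}k_1^{p_1}\cdots k_t^{p_t}$; this agrees with a polynomial in $n$, and $F_p(-n)$ denotes that polynomial evaluated at $-n$. A decomposition of an integer $m$ is a sequence of positive integers summing to $m$. For decompositions $p=(p_{1,1},\dots,p_{1,k_1},\dots,p_{l,1},\dots,p_{l,k_l})$ and $q=(q_1,\dots,q_l)$ of the same integer, $q$ coarsens $p$ (written $p\prec q$) if $p_{i,1}+\dots+p_{i,k_i}=q_i$ for each $i$. -}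

module Defs where

open import Data.Nat as ℕ using (ℕ; zero; suc; _^_; _<_)
open import Data.Integer as ℤ using (ℤ; +_)
open import Data.Rational as ℚ using (ℚ; 0ℚ; 1ℚ)
open import Data.List using (List; []; _∷_; map; concat; length)
open import Data.Nat.ListAction using (sum)
open import Data.List.Relation.Unary.All using (All)
open import Data.Product using (∃; _×_)
open import Relation.Binary.PropositionalEquality using (_≡_; _≢_)

sumFrom : ℕ → ℕ → (ℕ → ℕ) → ℕ
sumFrom lo zero    f = 0
sumFrom lo (suc m) f = f lo ℕ.+ sumFrom (suc lo) m f

Fb : ℕ → List ℕ → ℕ → ℕ
Fb lo []       n = 1
Fb lo (a ∷ ps) n = sumFrom lo (n ℕ.∸ lo) (λ k → (k ^ a) ℕ.* Fb (suc k) ps n)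

-- F_{p₁,…,pₜ}(n) = Σ_{0 ≤ k₁ < … < kₜ ≤ n-1} k₁^p₁ ⋯ kₜ^pₜ
F : List ℕ → ℕ → ℕ
F p n = Fb 0 p n

toℚ : ℕ → ℚ
toℚ n = + n ℚ./ 1

-- polynomial with rational coefficients, constant term first
Poly : Set
Poly = List ℚ

eval : Poly → ℚ → ℚ
eval []       x = 0ℚ
eval (c ∷ cs) x = c ℚ.+ x ℚ.* eval cs x

negOnePow : ℕ → ℚ
negOnePow zero    = 1ℚ
negOnePow (suc d) = ℚ.- negOnePow d

Positive : List ℕ → Set
Positive p = All (λ x → 0 < x) p

_≺_ : List ℕ → List ℕ → Set
p ≺ q = ∃ λ (blocks : List (List ℕ)) →
          All (λ b → b ≢ []) blocks × (concat blocks ≡ p) × (map sum blocks ≡ q)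

sumℚ : List ℚ → ℚ
sumℚ []       = 0ℚ
sumℚ (x ∷ xs) = x ℚ.+ sumℚ xs

-- Write S_p(n) for the sum of F_q(n) over the coarsenings q of p. Splitting off the last
-- summand gives F_{p,a}(n+1) = F_{p,a}(n) + F_p(n) n^a, and sorting the coarsenings of (p,c)
-- by whether c is a part of its own or is added to the last part gives the same recurrence
-- S_{p,c}(n+1) = S_{p,c}(n) + S_p(n+1) n^c. Hence the function E_p on ℤ that is F_p(n) at n ≥ 0
-- and (-1)^{d_p} S_p(n+1) at -n satisfies E_{p,a}(x+1) - E_{p,a}(x) = E_p(x) x^a at every integer
-- x (at x = -1 because S_p(1) = 0 when p is positive). By induction on p some iterated finite
-- difference of E_p vanishes, as does one of P; two such functions agreeing on ℕ agree on ℤ.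

module Submission where

open import Defs
open import Data.List.Base using (List; []; _∷_; _++_; _∷ʳ_; map; concat; length)
open import Data.List.Relation.Unary.All as All using (All; []; _∷_)
open import Data.List.Relation.Unary.Unique.Propositional using (Unique)
open import Data.List.Membership.Propositional using (_∈_)
open import Data.Nat.ListAction using (sum)
open import Data.Product using (∃; _×_; _,_)
open import Function.Base using (_∘_)
open import Function.Bundles using (_⇔_; mk⇔)
open import Relation.Binary.PropositionalEquality

module Combinatorics where

  open import Data.Nat.Base using (ℕ; zero; suc; _+_; _*_; _^_; _∸_; _<_; _≤_; z≤n; s≤s)
  open import Data.Nat.Properties
  open import Algebra.Properties.CommutativeSemigroup +-commutativeSemigroup
    using () renaming (interchange to +-interchange)
  import Data.Nat.Solver as ℕSolver
  open import Data.Nat.ListAction.Properties using (sum-++; sum-↭)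
  open import Data.List.Properties using (map-++; map-∘; map-cong; ∷-injectiveˡ; ∷-injectiveʳ)
  open import Data.List.NonEmpty.Base as List⁺ using (List⁺; _∷_; _∷⁺_; _⁺∷ʳ_; toList; snocView; _∷ʳ′_)
  import Data.List.Relation.Unary.All.Properties as AllP
  open import Data.List.Relation.Unary.Any using (here)
  open import Data.List.Membership.Propositional.Properties
    using (∈-map⁺; ∈-map⁻; ∈-++⁺ˡ; ∈-++⁺ʳ; ∈-++⁻)
  open import Data.List.Membership.Propositional.Properties.WithK using (unique∧set⇒bag)
  open import Data.List.Relation.Unary.AllPairs using ([]; _∷_)
  import Data.List.Relation.Unary.Unique.Propositional.Properties as Unique
  open import Data.List.Relation.Binary.Disjoint.Propositional using (Disjoint)
  open import Data.List.Relation.Binary.BagAndSetEquality using (∼bag⇒↭)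
  open import Data.List.Relation.Binary.Permutation.Propositional using (_↭_)
  open import Data.List.Relation.Binary.Permutation.Propositional.Properties using (map⁺)
  open import Data.Sum using (inj₁; inj₂)
  open import Data.Empty using (⊥-elim)
  import Function.Properties.Equivalence as ⇔

  sumFrom-snoc : ∀ lo m f → sumFrom lo (suc m) f ≡ sumFrom lo m f + f (lo + m)
  sumFrom-snoc lo zero    f = trans (+-identityʳ (f lo)) (cong f (sym (+-identityʳ lo)))
  sumFrom-snoc lo (suc m) f = begin
    f lo + sumFrom (suc lo) (suc m) f               ≡⟨ cong (f lo +_) (sumFrom-snoc (suc lo) m f) ⟩
    f lo + (sumFrom (suc lo) m f + f (suc lo + m))  ≡⟨ +-assoc (f lo) _ _ ⟨
    sumFrom lo (suc m) f + f (suc lo + m)           ≡⟨ cong (λ k → sumFrom lo (suc m) f + f k) (+-suc lo m) ⟨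
    sumFrom lo (suc m) f + f (lo + suc m)           ∎
    where open ≡-Reasoning

  sumFrom-to-suc : ∀ {lo n} f → lo ≤ n → sumFrom lo (suc n ∸ lo) f ≡ sumFrom lo (n ∸ lo) f + f n
  sumFrom-to-suc {lo} {n} f lo≤n = begin
    sumFrom lo (suc n ∸ lo) f
      ≡⟨ cong (λ m → sumFrom lo m f) (+-∸-assoc 1 lo≤n) ⟩
    sumFrom lo (suc (n ∸ lo)) f
      ≡⟨ sumFrom-snoc lo (n ∸ lo) f ⟩
    sumFrom lo (n ∸ lo) f + f (lo + (n ∸ lo))
      ≡⟨ cong (λ k → sumFrom lo (n ∸ lo) f + f k) (m+[n∸m]≡n lo≤n) ⟩
    sumFrom lo (n ∸ lo) f + f n
      ∎
    where open ≡-Reasoning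

  sumFrom-cong : ∀ lo m {f g} → (∀ k → k < lo + m → f k ≡ g k) → sumFrom lo m f ≡ sumFrom lo m g
  sumFrom-cong lo zero    f≗g = refl
  sumFrom-cong lo (suc m) f≗g = cong₂ _+_
    (f≗g lo (m<m+n lo (s≤s z≤n)))
    (sumFrom-cong (suc lo) m (λ k k< → f≗g k (subst (k <_) (sym (+-suc lo m)) k<)))

  sumFrom-+ : ∀ lo m f g → sumFrom lo m (λ k → f k + g k) ≡ sumFrom lo m f + sumFrom lo m g
  sumFrom-+ lo zero    f g = refl
  sumFrom-+ lo (suc m) f g = trans (cong (f lo + g lo +_) (sumFrom-+ (suc lo) m f g))
    (+-interchange (f lo) (g lo) _ _)

  sumFrom-*ʳ : ∀ lo m f c → sumFrom lo m (λ k → f k * c) ≡ sumFrom lo m f * c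
  sumFrom-*ʳ lo zero    f c = refl
  sumFrom-*ʳ lo (suc m) f c =
    trans (cong (f lo * c +_) (sumFrom-*ʳ (suc lo) m f c)) (sym (*-distribʳ-+ c (f lo) _))

  Fb-∷-≥ : ∀ x ps {lo n} → n ≤ lo → Fb lo (x ∷ ps) n ≡ 0
  Fb-∷-≥ x ps {lo} {n} n≤lo =
    cong (λ m → sumFrom lo m (λ k → k ^ x * Fb (suc k) ps n)) (m≤n⇒m∸n≡0 n≤lo)

  Fb-∷ʳ-≥ : ∀ ps a {lo n} → n ≤ lo → Fb lo (ps ∷ʳ a) n ≡ 0
  Fb-∷ʳ-≥ []       a = Fb-∷-≥ a []
  Fb-∷ʳ-≥ (x ∷ ps) a = Fb-∷-≥ x (ps ∷ʳ a)

  Fb-∷ʳ-suc : ∀ ps a {lo n} → lo ≤ n → Fb lo (ps ∷ʳ a) (suc n) ≡ Fb lo (ps ∷ʳ a) n + Fb lo ps n * n ^ a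
  Fb-∷ʳ-suc [] a {lo} {n} lo≤n =
    trans (sumFrom-to-suc (λ k → k ^ a * 1) lo≤n) (cong (Fb lo (a ∷ []) n +_) (*-comm (n ^ a) 1))
  Fb-∷ʳ-suc (b ∷ ps) a {lo} {n} lo≤n = begin
    sumFrom lo (suc n ∸ lo) (term (suc n))
      ≡⟨ sumFrom-to-suc (term (suc n)) lo≤n ⟩
    sumFrom lo (n ∸ lo) (term (suc n)) + n ^ b * Fb (suc n) (ps ∷ʳ a) (suc n)
      ≡⟨ cong₂ _+_ (sumFrom-cong lo (n ∸ lo) recurrence) (cong (n ^ b *_) (Fb-∷ʳ-≥ ps a ≤-refl)) ⟩
    sumFrom lo (n ∸ lo) (λ k → term n k + term₀ k * n ^ a) + n ^ b * 0
      ≡⟨ cong₂ _+_ (sumFrom-+ lo (n ∸ lo) (term n) (λ k → term₀ k * n ^ a)) (*-zeroʳ (n ^ b)) ⟩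
    Fb lo (b ∷ ps ∷ʳ a) n + sumFrom lo (n ∸ lo) (λ k → term₀ k * n ^ a) + 0
      ≡⟨ +-identityʳ _ ⟩
    Fb lo (b ∷ ps ∷ʳ a) n + sumFrom lo (n ∸ lo) (λ k → term₀ k * n ^ a)
      ≡⟨ cong (Fb lo (b ∷ ps ∷ʳ a) n +_) (sumFrom-*ʳ lo (n ∸ lo) term₀ (n ^ a)) ⟩
    Fb lo (b ∷ ps ∷ʳ a) n + Fb lo (b ∷ ps) n * n ^ a
      ∎
    where
    open ≡-Reasoning
    term : ℕ → ℕ → ℕ
    term m k = k ^ b * Fb (suc k) (ps ∷ʳ a) m
    term₀ : ℕ → ℕ
    term₀ k = k ^ b * Fb (suc k) ps n
    recurrence : ∀ k → k < lo + (n ∸ lo) → term (suc n) k ≡ term n k + term₀ k * n ^ a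
    recurrence k k< = begin
      k ^ b * Fb (suc k) (ps ∷ʳ a) (suc n)
        ≡⟨ cong (k ^ b *_) (Fb-∷ʳ-suc ps a (subst (k <_) (m+[n∸m]≡n lo≤n) k<)) ⟩
      k ^ b * (Fb (suc k) (ps ∷ʳ a) n + Fb (suc k) ps n * n ^ a)
        ≡⟨ *-distribˡ-+ (k ^ b) _ _ ⟩
      term n k + k ^ b * (Fb (suc k) ps n * n ^ a)
        ≡⟨ cong (term n k +_) (*-assoc (k ^ b) _ _) ⟨
      term n k + term₀ k * n ^ a
        ∎

  F-∷ʳ-suc : ∀ ps a n → F (ps ∷ʳ a) (suc n) ≡ F (ps ∷ʳ a) n + F ps n * n ^ a
  F-∷ʳ-suc ps a n = Fb-∷ʳ-suc ps a z≤n

  sum-map-++ : ∀ {A : Set} (f : A → ℕ) xs ys → sum (map f (xs ++ ys)) ≡ sum (map f xs) + sum (map f ys)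
  sum-map-++ f xs ys = trans (cong sum (map-++ f xs ys)) (sum-++ (map f xs) (map f ys))

  sum-map-++-map : ∀ {A B : Set} (f : B → ℕ) (g h : A → B) xs →
    sum (map f (map g xs ++ map h xs)) ≡ sum (map (f ∘ g) xs) + sum (map (f ∘ h) xs)
  sum-map-++-map f g h xs = trans (sum-map-++ f (map g xs) (map h xs))
    (sym (cong₂ (λ u v → sum u + sum v) (map-∘ xs) (map-∘ xs)))

  sum-map-+ : ∀ {A : Set} (f g : A → ℕ) xs → sum (map (λ x → f x + g x) xs) ≡ sum (map f xs) + sum (map g xs)
  sum-map-+ f g []       = refl
  sum-map-+ f g (x ∷ xs) = trans (cong (f x + g x +_) (sum-map-+ f g xs)) (+-interchange (f x) (g x) _ _)

  sum-map-*ʳ : ∀ {A : Set} (f : A → ℕ) c xs → sum (map (λ x → f x * c) xs) ≡ sum (map f xs) * c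
  sum-map-*ʳ f c []       = refl
  sum-map-*ʳ f c (x ∷ xs) = trans (cong (f x * c +_) (sum-map-*ʳ f c xs)) (sym (*-distribʳ-+ c (f x) _))

  sum-map-zero : ∀ {A : Set} (f : A → ℕ) {xs} → All (λ x → f x ≡ 0) xs → sum (map f xs) ≡ 0
  sum-map-zero f []         = refl
  sum-map-zero f (fx≡0 ∷ ps) = cong₂ _+_ fx≡0 (sum-map-zero f ps)

  mergeHead : ℕ → List⁺ ℕ → List⁺ ℕ
  mergeHead a (x ∷ xs) = a + x ∷ xs

  mergeLast : ℕ → List⁺ ℕ → List⁺ ℕ
  mergeLast c (x ∷ xs) = go x xs
    where
    go : ℕ → List ℕ → List⁺ ℕ
    go x []       = x + c ∷ []
    go x (y ∷ ys) = x ∷⁺ go y ys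

  mergeHead-mergeLast : ∀ a c q → mergeHead a (mergeLast c q) ≡ mergeLast c (mergeHead a q)
  mergeHead-mergeLast a c (x ∷ [])     = cong List⁺.[_] (sym (+-assoc a x c))
  mergeHead-mergeLast a c (x ∷ y ∷ ys) = refl

  toList-∷ʳ : ∀ (ys : List ℕ) x → toList (ys List⁺.∷ʳ x) ≡ ys ∷ʳ x
  toList-∷ʳ []       x = refl
  toList-∷ʳ (y ∷ ys) x = refl

  toList-mergeLast-∷ʳ : ∀ c ys x → toList (mergeLast c (ys List⁺.∷ʳ x)) ≡ ys ∷ʳ (x + c)
  toList-mergeLast-∷ʳ c []           x = refl
  toList-mergeLast-∷ʳ c (y ∷ [])     x = refl
  toList-mergeLast-∷ʳ c (y ∷ z ∷ ys) x = cong (y ∷_) (toList-mergeLast-∷ʳ c (z ∷ ys) x)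

  -- The coarsenings of a ∷ p, kept non-empty so that mergeHead and mergeLast are total.
  coarsenings⁺ : ℕ → List ℕ → List (List⁺ ℕ)
  coarsenings⁺ a []      = (a ∷ []) ∷ []
  coarsenings⁺ a (b ∷ p) = map (a ∷⁺_) (coarsenings⁺ b p) ++ map (mergeHead a) (coarsenings⁺ b p)

  coarsenings : List ℕ → List (List ℕ)
  coarsenings []      = [] ∷ []
  coarsenings (a ∷ p) = map toList (coarsenings⁺ a p)

  ≺-∷ : ∀ a {p q} → p ≺ q → (a ∷ p) ≺ (a ∷ q)
  ≺-∷ a (bs , ne , concat≡ , sums≡) =
    ((a ∷ []) ∷ bs) , (λ ()) ∷ ne , cong (a ∷_) concat≡ , cong₂ _∷_ (+-identityʳ a) sums≡

  ≺-merge : ∀ a {p x q} → p ≺ (x ∷ q) → (a ∷ p) ≺ (a + x ∷ q)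
  ≺-merge a ([]      , _      , _       , ())
  ≺-merge a (B ∷ bs , _ ∷ ne , concat≡ , sums≡) =
    ((a ∷ B) ∷ bs) , (λ ()) ∷ ne , cong (a ∷_) concat≡ ,
    cong₂ _∷_ (cong (a +_) (∷-injectiveˡ sums≡)) (∷-injectiveʳ sums≡)

  coarsenings⁺-sound : ∀ a p {q} → q ∈ coarsenings⁺ a p → (a ∷ p) ≺ toList q
  coarsenings⁺-sound a []      (here refl) = (a ∷ []) ∷ [] , (λ ()) ∷ [] , refl , cong (_∷ []) (+-identityʳ a)
  coarsenings⁺-sound a (b ∷ p) q∈ with ∈-++⁻ (map (a ∷⁺_) (coarsenings⁺ b p)) q∈
  ... | inj₁ q∈ˡ with ∈-map⁻ (a ∷⁺_) q∈ˡ
  ...   | q , q∈ , refl = ≺-∷ a (coarsenings⁺-sound b p q∈)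
  coarsenings⁺-sound a (b ∷ p) q∈ | inj₂ q∈ʳ with ∈-map⁻ (mergeHead a) q∈ʳ
  ...   | q , q∈ , refl = ≺-merge a (coarsenings⁺-sound b p q∈)

  coarsenings⁺-complete : ∀ a p bs → All (_≢ []) bs → concat bs ≡ a ∷ p →
    ∃ λ q → q ∈ coarsenings⁺ a p × toList q ≡ map sum bs
  coarsenings⁺-complete a p       []                ne               ()
  coarsenings⁺-complete a p       ([] ∷ bs)         ([]≢[] ∷ _)      _  = ⊥-elim ([]≢[] refl)
  coarsenings⁺-complete a []      ((x ∷ []) ∷ [])   _                eq =
    (a ∷ []) , here refl , cong (_∷ []) (trans (sym (∷-injectiveˡ eq)) (sym (+-identityʳ x)))
  coarsenings⁺-complete a []      ((x ∷ []) ∷ [] ∷ bs) (_ ∷ []≢[] ∷ _) _ = ⊥-elim ([]≢[] refl)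
  coarsenings⁺-complete a []      ((x ∷ []) ∷ (y ∷ B) ∷ bs) _        ()
  coarsenings⁺-complete a []      ((x ∷ y ∷ B) ∷ bs) _               ()
  coarsenings⁺-complete a (b ∷ p) ((x ∷ []) ∷ bs)   (_ ∷ ne)         eq
    with coarsenings⁺-complete b p bs ne (∷-injectiveʳ eq)
  ... | q , q∈ , q≡ = a ∷⁺ q , ∈-++⁺ˡ (∈-map⁺ (a ∷⁺_) q∈) ,
                      cong₂ _∷_ (trans (sym (∷-injectiveˡ eq)) (sym (+-identityʳ x))) q≡
  coarsenings⁺-complete a (b ∷ p) ((x ∷ y ∷ B) ∷ bs) (_ ∷ ne)        eq
    with coarsenings⁺-complete b p ((y ∷ B) ∷ bs) ((λ ()) ∷ ne) (∷-injectiveʳ eq)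
  ... | q , q∈ , q≡ = mergeHead a q ,
                      ∈-++⁺ʳ (map (a ∷⁺_) (coarsenings⁺ b p)) (∈-map⁺ (mergeHead a) q∈) ,
                      cong₂ _∷_ (cong₂ _+_ (sym (∷-injectiveˡ eq)) (∷-injectiveˡ q≡)) (∷-injectiveʳ q≡)

  ∈-coarsenings⇔≺ : ∀ a p q → q ∈ coarsenings (a ∷ p) ⇔ (a ∷ p) ≺ q
  ∈-coarsenings⇔≺ a p q = mk⇔ to from
    where
    to : q ∈ coarsenings (a ∷ p) → (a ∷ p) ≺ q
    to q∈ with ∈-map⁻ toList q∈
    ... | q⁺ , q⁺∈ , refl = coarsenings⁺-sound a p q⁺∈
    from : (a ∷ p) ≺ q → q ∈ coarsenings (a ∷ p)
    from (bs , ne , concat≡ , sums≡) with coarsenings⁺-complete a p bs ne concat≡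
    ... | q⁺ , q⁺∈ , q⁺≡ = subst (_∈ coarsenings (a ∷ p)) (trans q⁺≡ sums≡) (∈-map⁺ toList q⁺∈)

  head-coarsenings⁺ : ∀ a p → All (λ q → a ≤ List⁺.head q) (coarsenings⁺ a p)
  head-coarsenings⁺ a []      = ≤-refl ∷ []
  head-coarsenings⁺ a (b ∷ p) = AllP.++⁺
    (AllP.map⁺ (All.map (λ _ → ≤-refl) (head-coarsenings⁺ b p)))
    (AllP.map⁺ (All.map (λ {q} _ → m≤m+n a (List⁺.head q)) (head-coarsenings⁺ b p)))

  toList-injective : ∀ {q q′ : List⁺ ℕ} → toList q ≡ toList q′ → q ≡ q′
  toList-injective eq = cong₂ _∷_ (∷-injectiveˡ eq) (∷-injectiveʳ eq)

  mergeHead-injective : ∀ a {q q′} → mergeHead a q ≡ mergeHead a q′ → q ≡ q′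
  mergeHead-injective a eq =
    cong₂ _∷_ (+-cancelˡ-≡ a _ _ (cong List⁺.head eq)) (cong List⁺.tail eq)

  coarsenings⁺-unique : ∀ a p → Positive p → Unique (coarsenings⁺ a p)
  coarsenings⁺-unique a []      _           = [] ∷ []
  coarsenings⁺-unique a (b ∷ p) (0<b ∷ pos) =
    Unique.++⁺ (Unique.map⁺ (toList-injective ∘ cong List⁺.tail) unique)
               (Unique.map⁺ (mergeHead-injective a) unique)
               disjoint
    where
    unique = coarsenings⁺-unique b p pos
    disjoint : Disjoint (map (a ∷⁺_) (coarsenings⁺ b p)) (map (mergeHead a) (coarsenings⁺ b p))
    disjoint (v∈ˡ , v∈ʳ) with ∈-map⁻ (a ∷⁺_) v∈ˡ | ∈-map⁻ (mergeHead a) v∈ʳ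
    ... | _ , _ , refl | q , q∈ , eq =
      <⇒≢ (m<m+n a (<-≤-trans 0<b (All.lookup (head-coarsenings⁺ b p) q∈))) (cong List⁺.head eq)

  coarsenings-unique : ∀ a p → Positive p → Unique (coarsenings (a ∷ p))
  coarsenings-unique a p pos = Unique.map⁺ toList-injective (coarsenings⁺-unique a p pos)

  ↭-coarsenings : ∀ a p {L} → Positive p → Unique L → (∀ q → q ∈ L ⇔ (a ∷ p) ≺ q) →
    L ↭ coarsenings (a ∷ p)
  ↭-coarsenings a p pos uniqueL L⇔≺ = ∼bag⇒↭ (unique∧set⇒bag uniqueL (coarsenings-unique a p pos)
    λ {q} → ⇔.trans (L⇔≺ q) (⇔.sym (∈-coarsenings⇔≺ a p q)))

  Fcoarse : List ℕ → ℕ → ℕ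
  Fcoarse p n = sum (map (λ q → F q n) (coarsenings p))

  Fcoarse-∷ : ∀ a p n → Fcoarse (a ∷ p) n ≡ sum (map (λ q → F (toList q) n) (coarsenings⁺ a p))
  Fcoarse-∷ a p n = cong sum (sym (map-∘ (coarsenings⁺ a p)))

  sum-coarsenings⁺-∷ʳ : ∀ (f : List⁺ ℕ → ℕ) a p c →
    sum (map f (coarsenings⁺ a (p ∷ʳ c)))
      ≡ sum (map (λ q → f (q ⁺∷ʳ c) + f (mergeLast c q)) (coarsenings⁺ a p))
  sum-coarsenings⁺-∷ʳ f a []      c = sym (+-assoc (f (a ∷ c ∷ [])) (f (a + c ∷ [])) 0)
  sum-coarsenings⁺-∷ʳ f a (b ∷ p) c = begin
    sum (map f (map (a ∷⁺_) X ++ map (mergeHead a) X))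
      ≡⟨ sum-map-++-map f (a ∷⁺_) (mergeHead a) X ⟩
    sum (map (f ∘ (a ∷⁺_)) X) + sum (map (f ∘ mergeHead a) X)
      ≡⟨ cong₂ _+_ (sum-coarsenings⁺-∷ʳ (f ∘ (a ∷⁺_)) b p c)
                   (sum-coarsenings⁺-∷ʳ (f ∘ mergeHead a) b p c) ⟩
    sum (map (g ∘ (a ∷⁺_)) Y) + sum (map (λ q → f (mergeHead a q ⁺∷ʳ c) + f (mergeHead a (mergeLast c q))) Y)
      ≡⟨ cong (λ u → sum (map (g ∘ (a ∷⁺_)) Y) + sum u)
              (map-cong (λ q → cong (λ r → f (mergeHead a q ⁺∷ʳ c) + f r) (mergeHead-mergeLast a c q)) Y) ⟩
    sum (map (g ∘ (a ∷⁺_)) Y) + sum (map (g ∘ mergeHead a) Y)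
      ≡⟨ sum-map-++-map g (a ∷⁺_) (mergeHead a) Y ⟨
    sum (map g (map (a ∷⁺_) Y ++ map (mergeHead a) Y))
      ∎
    where
    open ≡-Reasoning
    X = coarsenings⁺ b (p ∷ʳ c)
    Y = coarsenings⁺ b p
    g : List⁺ ℕ → ℕ
    g q = f (q ⁺∷ʳ c) + f (mergeLast c q)

  F-∷ʳ-merge-suc : ∀ {r s} ys x c M → r ≡ ys ∷ʳ x → s ≡ ys ∷ʳ (x + c) →
    F (r ∷ʳ c) (suc M) + F s (suc M) ≡ F (r ∷ʳ c) M + F s M + F r (suc M) * M ^ c
  F-∷ʳ-merge-suc ys x c M refl refl = begin
    F (ys ∷ʳ x ∷ʳ c) (suc M) + F (ys ∷ʳ (x + c)) (suc M)
      ≡⟨ cong₂ _+_ (F-∷ʳ-suc (ys ∷ʳ x) c M) (F-∷ʳ-suc ys (x + c) M) ⟩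
    A + Q * M ^ c + (B + Z * M ^ (x + c))
      ≡⟨ cong (λ t → A + Q * M ^ c + (B + Z * t)) (^-distribˡ-+-* M x c) ⟩
    A + Q * M ^ c + (B + Z * (M ^ x * M ^ c))
      ≡⟨ regroup A Q B Z (M ^ x) (M ^ c) ⟩
    A + B + (Q + Z * M ^ x) * M ^ c
      ≡⟨ cong (λ t → A + B + t * M ^ c) (F-∷ʳ-suc ys x M) ⟨
    A + B + F (ys ∷ʳ x) (suc M) * M ^ c
      ∎
    where
    open ≡-Reasoning
    A = F (ys ∷ʳ x ∷ʳ c) M
    B = F (ys ∷ʳ (x + c)) M
    Q = F (ys ∷ʳ x) M
    Z = F ys M
    regroup : ∀ A Q B Z Mx Mc → A + Q * Mc + (B + Z * (Mx * Mc)) ≡ A + B + (Q + Z * Mx) * Mc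
    regroup = solve 6 (λ A Q B Z Mx Mc → A :+ Q :* Mc :+ (B :+ Z :* (Mx :* Mc)) := A :+ B :+ (Q :+ Z :* Mx) :* Mc) refl
      where open ℕSolver.+-*-Solver

  F-∷ʳ-mergeLast-suc : ∀ q c M →
    F (toList q ∷ʳ c) (suc M) + F (toList (mergeLast c q)) (suc M)
      ≡ F (toList q ∷ʳ c) M + F (toList (mergeLast c q)) M + F (toList q) (suc M) * M ^ c
  F-∷ʳ-mergeLast-suc q c M with snocView q
  ... | ys ∷ʳ′ x = F-∷ʳ-merge-suc ys x c M (toList-∷ʳ ys x) (toList-mergeLast-∷ʳ c ys x)

  Fcoarse-∷ʳ-suc : ∀ p c M → Fcoarse (p ∷ʳ c) (suc M) ≡ Fcoarse (p ∷ʳ c) M + Fcoarse p (suc M) * M ^ c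
  Fcoarse-∷ʳ-suc []      c M =
    trans (+-identityʳ _) (trans (F-∷ʳ-suc [] c M) (cong (_+ 1 * M ^ c) (sym (+-identityʳ (F (c ∷ []) M)))))
  Fcoarse-∷ʳ-suc (a ∷ p) c M = begin
    Fcoarse (a ∷ p ∷ʳ c) (suc M)
      ≡⟨ Fcoarse-∷ a (p ∷ʳ c) (suc M) ⟩
    sum (map (F⁺ (suc M)) (coarsenings⁺ a (p ∷ʳ c)))
      ≡⟨ sum-coarsenings⁺-∷ʳ (F⁺ (suc M)) a p c ⟩
    sum (map (λ q → F⁺ (suc M) (q ⁺∷ʳ c) + F⁺ (suc M) (mergeLast c q)) Q)
      ≡⟨ cong sum (map-cong (λ q → F-∷ʳ-mergeLast-suc q c M) Q) ⟩
    sum (map (λ q → F⁺ M (q ⁺∷ʳ c) + F⁺ M (mergeLast c q) + F⁺ (suc M) q * M ^ c) Q)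
      ≡⟨ sum-map-+ (λ q → F⁺ M (q ⁺∷ʳ c) + F⁺ M (mergeLast c q)) (λ q → F⁺ (suc M) q * M ^ c) Q ⟩
    sum (map (λ q → F⁺ M (q ⁺∷ʳ c) + F⁺ M (mergeLast c q)) Q) + sum (map (λ q → F⁺ (suc M) q * M ^ c) Q)
      ≡⟨ cong₂ _+_ (sym (sum-coarsenings⁺-∷ʳ (F⁺ M) a p c)) (sum-map-*ʳ (F⁺ (suc M)) (M ^ c) Q) ⟩
    sum (map (F⁺ M) (coarsenings⁺ a (p ∷ʳ c))) + sum (map (F⁺ (suc M)) Q) * M ^ c
      ≡⟨ cong₂ (λ u v → u + v * M ^ c) (Fcoarse-∷ a (p ∷ʳ c) M) (Fcoarse-∷ a p (suc M)) ⟨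
    Fcoarse (a ∷ p ∷ʳ c) M + Fcoarse (a ∷ p) (suc M) * M ^ c
      ∎
    where
    open ≡-Reasoning
    Q = coarsenings⁺ a p
    F⁺ : ℕ → List⁺ ℕ → ℕ
    F⁺ n q = F (toList q) n

  F-∷-one : ∀ {x} q → 0 < x → F (x ∷ q) 1 ≡ 0
  F-∷-one {suc x} q _ = refl

  Fcoarse-one : ∀ {a} p → 0 < a → Fcoarse (a ∷ p) 1 ≡ 0
  Fcoarse-one {a} p 0<a = trans (Fcoarse-∷ a p 1)
    (sum-map-zero _ (All.map (λ {q} a≤h → F-∷-one (List⁺.tail q) (<-≤-trans 0<a a≤h))
                             (head-coarsenings⁺ a p)))

  sum-F-coarsenings : ∀ a p n {L} → Positive p → Unique L → (∀ q → q ∈ L ⇔ (a ∷ p) ≺ q) →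
    sum (map (λ q → F q n) L) ≡ Fcoarse (a ∷ p) n
  sum-F-coarsenings a p n pos uniqueL L⇔≺ = sum-↭ (map⁺ (λ q → F q n) (↭-coarsenings a p pos uniqueL L⇔≺))

module FiniteDifferences where

  open import Data.Nat.Base as ℕ using (ℕ; zero; suc; _≤_; z≤n; s≤s)
  import Data.Nat.Coprimality as Coprime
  open import Data.Integer.Base as ℤ using (ℤ; +_; -[1+_])
  import Data.Integer.Properties as ℤ
  open import Data.Rational.Base using (ℚ; mkℚ; 0ℚ; 1ℚ; _+_; _*_; _-_; -_; _/_)
  import Data.Rational.Properties as ℚ
  open import Algebra.Definitions.RawSemiring Data.Rational.Base.+-*-rawSemiring using (_^_)
  open import Data.Rational.Solver using (module +-*-Solver)

  toℚ≡mkℚ : ∀ n → toℚ n ≡ mkℚ (+ n) 0 (Coprime.sym (Coprime.1-coprimeTo n))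
  toℚ≡mkℚ n = ℚ.normalize-coprime (Coprime.sym (Coprime.1-coprimeTo n))

  toℚ-+ : ∀ m n → toℚ (m ℕ.+ n) ≡ toℚ m + toℚ n
  toℚ-+ m n rewrite toℚ≡mkℚ m | toℚ≡mkℚ n =
    sym (cong₂ (λ a b → (a ℤ.+ b) / 1) (ℤ.*-identityʳ (+ m)) (ℤ.*-identityʳ (+ n)))

  toℚ-* : ∀ m n → toℚ (m ℕ.* n) ≡ toℚ m * toℚ n
  toℚ-* m n rewrite toℚ≡mkℚ m | toℚ≡mkℚ n = cong (_/ 1) (ℤ.pos-* m n)

  toℚ-^ : ∀ n a → toℚ (n ℕ.^ a) ≡ toℚ n ^ a
  toℚ-^ n zero    = refl
  toℚ-^ n (suc a) = trans (toℚ-* n (n ℕ.^ a)) (cong (toℚ n *_) (toℚ-^ n a))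

  -- Definitionally ι (+ n) = toℚ n and ι -[1+ n ] = - toℚ (suc n).
  ι : ℤ → ℚ
  ι x = x / 1

  ι-suc : ∀ x → ι (ℤ.suc x) ≡ ι x + 1ℚ
  ι-suc (+ n)            = trans (toℚ-+ 1 n) (ℚ.+-comm 1ℚ (toℚ n))
  ι-suc -[1+ zero ]      = refl
  ι-suc -[1+ suc n ]     = begin
    - toℚ (suc n)                         ≡⟨ cong -_ (toℚ-+ 1 n) ⟩
    - (1ℚ + toℚ n)                        ≡⟨ shift (toℚ n) ⟩
    - (1ℚ + (1ℚ + toℚ n)) + 1ℚ            ≡⟨ cong (λ t → - (1ℚ + t) + 1ℚ) (toℚ-+ 1 n) ⟨
    - (1ℚ + toℚ (suc n)) + 1ℚ             ≡⟨ cong (λ t → - t + 1ℚ) (toℚ-+ 1 (suc n)) ⟨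
    - toℚ (suc (suc n)) + 1ℚ              ∎
    where
    open ≡-Reasoning
    shift : ∀ y → - (1ℚ + y) ≡ - (1ℚ + (1ℚ + y)) + 1ℚ
    shift = solve 1 (λ y → :- (con 1ℚ :+ y) := :- (con 1ℚ :+ (con 1ℚ :+ y)) :+ con 1ℚ) refl
      where open +-*-Solver

  Δ : (ℤ → ℚ) → ℤ → ℚ
  Δ f x = f (ℤ.suc x) - f x

  DegreeBelow : ℕ → (ℤ → ℚ) → Set
  DegreeBelow zero    f = ∀ x → f x ≡ 0ℚ
  DegreeBelow (suc d) f = DegreeBelow d (Δ f)

  Δ-+ : ∀ f g x → Δ (λ y → f y + g y) x ≡ Δ f x + Δ g x
  Δ-+ f g x = interchange (f (ℤ.suc x)) (g (ℤ.suc x)) (f x) (g x)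
    where
    interchange : ∀ a b c d → (a + b) - (c + d) ≡ (a - c) + (b - d)
    interchange = solve 4 (λ a b c d → (a :+ b) :- (c :+ d) := (a :- c) :+ (b :- d)) refl
      where open +-*-Solver

  degree-cong : ∀ d {f g} → (∀ x → f x ≡ g x) → DegreeBelow d f → DegreeBelow d g
  degree-cong zero    f≗g f≗0 x = trans (sym (f≗g x)) (f≗0 x)
  degree-cong (suc d) f≗g deg   = degree-cong d (λ x → cong₂ _-_ (f≗g (ℤ.suc x)) (f≗g x)) deg

  degree-zero : ∀ d {f} → (∀ x → f x ≡ 0ℚ) → DegreeBelow d f
  degree-zero zero    f≗0 = f≗0
  degree-zero (suc d) f≗0 =
    degree-zero d (λ x → trans (cong₂ _-_ (f≗0 (ℤ.suc x)) (f≗0 x)) (ℚ.+-inverseʳ 0ℚ))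

  degree-suc : ∀ d {f} → DegreeBelow d f → DegreeBelow (suc d) f
  degree-suc zero    f≗0 = degree-zero 1 f≗0
  degree-suc (suc d) {f} deg = degree-suc d {Δ f} deg

  degree-≤ : ∀ {d e f} → d ≤ e → DegreeBelow d f → DegreeBelow e f
  degree-≤ {e = zero}      z≤n       deg = deg
  degree-≤ {e = suc e} {f} z≤n       deg = degree-suc e {f} (degree-≤ {e = e} z≤n deg)
  degree-≤ {f = f}         (s≤s d≤e) deg = degree-≤ {f = Δ f} d≤e deg

  degree-const : ∀ d c → DegreeBelow (suc d) (λ _ → c)
  degree-const d c = degree-zero d (λ _ → ℚ.+-inverseʳ c)

  degree-+ : ∀ d {f g} → DegreeBelow d f → DegreeBelow d g → DegreeBelow d (λ x → f x + g x)
  degree-+ zero    f≗0 g≗0 x = trans (cong₂ _+_ (f≗0 x) (g≗0 x)) (ℚ.+-identityˡ 0ℚ)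
  degree-+ (suc d) {f} {g} degf degg =
    degree-cong d (λ x → sym (Δ-+ f g x)) (degree-+ d {Δ f} {Δ g} degf degg)

  degree-suc∘ : ∀ d {f} → DegreeBelow d f → DegreeBelow d (f ∘ ℤ.suc)
  degree-suc∘ zero    f≗0 x = f≗0 (ℤ.suc x)
  degree-suc∘ (suc d) deg   = degree-suc∘ d deg

  Δ-ι* : ∀ f x → Δ (λ y → ι y * f y) x ≡ ι x * Δ f x + f (ℤ.suc x)
  Δ-ι* f x = trans (cong (λ i → i * f (ℤ.suc x) - ι x * f x) (ι-suc x))
                   (Δ-ι*-identity (ι x) (f (ℤ.suc x)) (f x))
    where
    Δ-ι*-identity : ∀ i a b → (i + 1ℚ) * a - i * b ≡ i * (a - b) + a
    Δ-ι*-identity = solve 3 (λ i a b → (i :+ con 1ℚ) :* a :- i :* b := i :* (a :- b) :+ a) refl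
      where open +-*-Solver

  degree-ι* : ∀ d {f} → DegreeBelow d f → DegreeBelow (suc d) (λ x → ι x * f x)
  degree-ι* zero    f≗0 = degree-suc 0 (λ x → trans (cong (ι x *_) (f≗0 x)) (ℚ.*-zeroʳ (ι x)))
  degree-ι* (suc d) {f} deg =
    degree-cong (suc d) (λ x → sym (Δ-ι* f x))
      (degree-+ (suc d) {λ x → ι x * Δ f x} {f ∘ ℤ.suc} (degree-ι* d {Δ f} deg) (degree-suc∘ (suc d) {f} deg))

  degree-*ι^ : ∀ a d {f} → DegreeBelow d f → DegreeBelow (a ℕ.+ d) (λ x → f x * ι x ^ a)
  degree-*ι^ zero    d {f} deg = degree-cong d (λ x → sym (ℚ.*-identityʳ (f x))) deg
  degree-*ι^ (suc a) d {f} deg =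
    degree-cong (suc (a ℕ.+ d)) (λ x → swap (ι x) (f x) (ι x ^ a)) (degree-ι* (a ℕ.+ d) (degree-*ι^ a d deg))
    where
    swap : ∀ i u v → i * (u * v) ≡ u * (i * v)
    swap = solve 3 (λ i u v → i :* (u :* v) := u :* (i :* v)) refl
      where open +-*-Solver

  degree-eval : ∀ P → DegreeBelow (length P) (eval P ∘ ι)
  degree-eval []       = degree-zero 0 (λ _ → refl)
  degree-eval (c ∷ cs) = degree-+ (suc (length cs)) {λ _ → c} {λ x → ι x * eval cs (ι x)}
    (degree-const (length cs) c) (degree-ι* (length cs) (degree-eval cs))

  agree-from-Δ : ∀ {f g} → (∀ x → Δ f x ≡ Δ g x) → (∀ n → f (+ n) ≡ g (+ n)) → ∀ x → f x ≡ g x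
  agree-from-Δ {f} {g} Δf≗Δg agree = go
    where
    recover : ∀ a b → b ≡ a - (a - b)
    recover = solve 2 (λ a b → b := a :- (a :- b)) refl
      where open +-*-Solver
    back : ∀ x → f (ℤ.suc x) ≡ g (ℤ.suc x) → f x ≡ g x
    back x eq = begin
      f x                  ≡⟨ recover (f (ℤ.suc x)) (f x) ⟩
      f (ℤ.suc x) - Δ f x  ≡⟨ cong₂ _-_ eq (Δf≗Δg x) ⟩
      g (ℤ.suc x) - Δ g x  ≡⟨ recover (g (ℤ.suc x)) (g x) ⟨
      g x                  ∎
      where open ≡-Reasoning
    go : ∀ x → f x ≡ g x
    go (+ n)          = agree n
    go -[1+ zero ]    = back -[1+ zero ] (agree 0)
    go -[1+ suc n ]   = back -[1+ suc n ] (go -[1+ n ])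

  degree-agree : ∀ d {f g} → DegreeBelow d f → DegreeBelow d g →
    (∀ n → f (+ n) ≡ g (+ n)) → ∀ x → f x ≡ g x
  degree-agree zero    f≗0 g≗0 _ x = trans (f≗0 x) (sym (g≗0 x))
  degree-agree (suc d) {f} {g} degf degg agree =
    agree-from-Δ (degree-agree d {Δ f} {Δ g} degf degg (λ n → cong₂ _-_ (agree (suc n)) (agree n))) agree

module Extension where

  open Combinatorics
  open FiniteDifferences
  open import Data.List.Reverse using (Reverse; []; _∶_∶ʳ_; reverseView)
  open import Data.List.Properties using (length-++)
  open import Data.List.Relation.Unary.All.Properties using (∷ʳ⁻)
  open import Data.Nat.Base as ℕ using (ℕ; zero; suc; _<_)
  import Data.Nat.Properties as ℕ
  open import Data.Nat.ListAction.Properties using (sum-++)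
  import Data.Nat.Solver as ℕSolver
  open import Data.Integer.Base as ℤ using (ℤ; +_; -[1+_])
  open import Data.Rational.Base using (ℚ; 1ℚ; _+_; _*_; _-_; -_)
  import Data.Rational.Properties as ℚ
  open import Algebra.Properties.AbelianGroup ℚ.+-0-abelianGroup using (xyx⁻¹≈y)
  open import Algebra.Definitions.RawSemiring Data.Rational.Base.+-*-rawSemiring using (_^_)
  open import Data.Rational.Solver using (module +-*-Solver)

  toℚ-+*^ : ∀ u v n a → toℚ (u ℕ.+ v ℕ.* n ℕ.^ a) ≡ toℚ u + toℚ v * toℚ n ^ a
  toℚ-+*^ u v n a =
    trans (toℚ-+ u (v ℕ.* n ℕ.^ a))
          (cong (_+_ (toℚ u)) (trans (toℚ-* v (n ℕ.^ a)) (cong (toℚ v *_) (toℚ-^ n a))))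

  sumℚ-map-toℚ : ∀ {A : Set} (g : A → ℕ) xs → sumℚ (map (toℚ ∘ g) xs) ≡ toℚ (sum (map g xs))
  sumℚ-map-toℚ g []       = refl
  sumℚ-map-toℚ g (x ∷ xs) = trans (cong (_+_ (toℚ (g x))) (sumℚ-map-toℚ g xs)) (sym (toℚ-+ (g x) _))

  negOnePow-+ : ∀ m n → negOnePow (m ℕ.+ n) ≡ negOnePow m * negOnePow n
  negOnePow-+ zero    n = sym (ℚ.*-identityˡ (negOnePow n))
  negOnePow-+ (suc m) n = trans (cong -_ (negOnePow-+ m n)) (ℚ.neg-distribˡ-* (negOnePow m) (negOnePow n))

  neg-^ : ∀ x a → (- x) ^ a ≡ negOnePow a * x ^ a
  neg-^ x zero    = sym (ℚ.*-identityˡ 1ℚ)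
  neg-^ x (suc a) = trans (cong (- x *_) (neg-^ x a)) (swap x (negOnePow a) (x ^ a))
    where
    swap : ∀ x s y → - x * (s * y) ≡ - s * (x * y)
    swap = solve 3 (λ x s y → :- x :* (s :* y) := :- s :* (x :* y)) refl
      where open +-*-Solver

  sign : List ℕ → ℚ
  sign p = negOnePow (sum p ℕ.+ length p)

  sign-∷ʳ : ∀ p a → sign (p ∷ʳ a) ≡ - (sign p * negOnePow a)
  sign-∷ʳ p a = trans (cong negOnePow exponent) (cong -_ (negOnePow-+ (sum p ℕ.+ length p) a))
    where
    exponent : sum (p ∷ʳ a) ℕ.+ length (p ∷ʳ a) ≡ suc (sum p ℕ.+ length p ℕ.+ a)
    exponent = begin
      sum (p ∷ʳ a) ℕ.+ length (p ∷ʳ a)     ≡⟨ cong₂ ℕ._+_ (sum-++ p (a ∷ [])) (length-++ p) ⟩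
      sum p ℕ.+ (a ℕ.+ 0) ℕ.+ (length p ℕ.+ 1) ≡⟨ regroup (sum p) a (length p) ⟩
      suc (sum p ℕ.+ length p ℕ.+ a)       ∎
      where
      open ≡-Reasoning
      regroup : ∀ s a l → s ℕ.+ (a ℕ.+ 0) ℕ.+ (l ℕ.+ 1) ≡ suc (s ℕ.+ l ℕ.+ a)
      regroup = solve 3 (λ s a l → s :+ (a :+ con 0) :+ (l :+ con 1) := con 1 :+ (s :+ l :+ a)) refl
        where open ℕSolver.+-*-Solver

  Fneg : List ℕ → ℕ → ℚ
  Fneg p n = sign p * toℚ (Fcoarse p (suc n))

  -- The recurrence of Fcoarse at m + 1 read backwards: sign (p ∷ʳ a) = (-1)^(a+1) sign p
  -- absorbs both the sign of (-(m+1))^a and the reversal of the difference.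
  Fneg-∷ʳ : ∀ p a m → Fneg (p ∷ʳ a) m ≡ Fneg (p ∷ʳ a) (suc m) + Fneg p (suc m) * (- toℚ (suc m)) ^ a
  Fneg-∷ʳ p a m = begin
    sign (p ∷ʳ a) * X
      ≡⟨ cong (_* X) (sign-∷ʳ p a) ⟩
    - (sp * sa) * X
      ≡⟨ regroup sp sa X Y Pa ⟩
    - (sp * sa) * (X + Y * Pa) + sp * Y * (sa * Pa)
      ≡⟨ cong₂ (λ s u → s * u + sp * Y * (sa * Pa)) (sign-∷ʳ p a) coarse-step ⟨
    sign (p ∷ʳ a) * toℚ (Fcoarse (p ∷ʳ a) (suc (suc m))) + sp * Y * (sa * Pa)
      ≡⟨ cong (λ t → Fneg (p ∷ʳ a) (suc m) + sp * Y * t) (neg-^ (toℚ (suc m)) a) ⟨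
    Fneg (p ∷ʳ a) (suc m) + Fneg p (suc m) * (- toℚ (suc m)) ^ a
      ∎
    where
    open ≡-Reasoning
    sp = sign p
    sa = negOnePow a
    X  = toℚ (Fcoarse (p ∷ʳ a) (suc m))
    Y  = toℚ (Fcoarse p (suc (suc m)))
    Pa = toℚ (suc m) ^ a
    coarse-step : toℚ (Fcoarse (p ∷ʳ a) (suc (suc m))) ≡ X + Y * Pa
    coarse-step = trans (cong toℚ (Fcoarse-∷ʳ-suc p a (suc m)))
                        (toℚ-+*^ (Fcoarse (p ∷ʳ a) (suc m)) (Fcoarse p (suc (suc m))) (suc m) a)
    regroup : ∀ sp sa X Y Pa → - (sp * sa) * X ≡ - (sp * sa) * (X + Y * Pa) + sp * Y * (sa * Pa)
    regroup = solve 5 (λ sp sa X Y Pa →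
      :- (sp :* sa) :* X := :- (sp :* sa) :* (X :+ Y :* Pa) :+ sp :* Y :* (sa :* Pa)) refl
      where open +-*-Solver

  Fneg-zero : ∀ {x} q → 0 < x → Fneg (x ∷ q) 0 ≡ toℚ (F (x ∷ q) 0)
  Fneg-zero {x} q 0<x = trans (cong (λ n → sign (x ∷ q) * toℚ n) (Fcoarse-one q 0<x)) (ℚ.*-zeroʳ (sign (x ∷ q)))

  Fneg-∷ʳ-zero : ∀ p a → Positive p → 0 < a → Fneg (p ∷ʳ a) 0 ≡ toℚ (F (p ∷ʳ a) 0)
  Fneg-∷ʳ-zero []      a _          0<a = Fneg-zero [] 0<a
  Fneg-∷ʳ-zero (x ∷ p) a (0<x ∷ _) _   = Fneg-zero (p ∷ʳ a) 0<x

  Fℤ : List ℕ → ℤ → ℚ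
  Fℤ p (+ n)    = toℚ (F p n)
  Fℤ p -[1+ n ] = Fneg p (suc n)

  Fℤ-∷ʳ-suc : ∀ p a → Positive p → 0 < a →
    ∀ x → Fℤ (p ∷ʳ a) (ℤ.suc x) ≡ Fℤ (p ∷ʳ a) x + Fℤ p x * ι x ^ a
  Fℤ-∷ʳ-suc p a _   _   (+ n)         =
    trans (cong toℚ (F-∷ʳ-suc p a n)) (toℚ-+*^ (F (p ∷ʳ a) n) (F p n) n a)
  Fℤ-∷ʳ-suc p a pos 0<a -[1+ zero ]   = trans (sym (Fneg-∷ʳ-zero p a pos 0<a)) (Fneg-∷ʳ p a 0)
  Fℤ-∷ʳ-suc p a _   _   -[1+ suc m ]  = Fneg-∷ʳ p a (suc m)

  degree-Fℤ : ∀ p → Positive p → ∃ λ d → DegreeBelow d (Fℤ p)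
  degree-Fℤ p = go (reverseView p)
    where
    go : ∀ {p} → Reverse p → Positive p → ∃ λ d → DegreeBelow d (Fℤ p)
    go []             _   = 1 , degree-cong 1 Fℤ-[] (degree-const 0 1ℚ)
      where
      Fℤ-[] : ∀ x → 1ℚ ≡ Fℤ [] x
      Fℤ-[] (+ n)    = refl
      Fℤ-[] -[1+ n ] = refl
    go (p ∶ view ∶ʳ a) pos with ∷ʳ⁻ pos
    ... | pos′ , 0<a with go view pos′
    ...   | d , deg = suc (a ℕ.+ d) , degree-cong (a ℕ.+ d) ΔFℤ (degree-*ι^ a d deg)
      where
      ΔFℤ : ∀ x → Fℤ p x * ι x ^ a ≡ Δ (Fℤ (p ∷ʳ a)) x
      ΔFℤ x = sym (trans (cong (_- Fℤ (p ∷ʳ a) x) (Fℤ-∷ʳ-suc p a pos′ 0<a x))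
                         (xyx⁻¹≈y (Fℤ (p ∷ʳ a) x) _))

  eval≗Fℤ : ∀ p P → Positive p → (∀ n → eval P (toℚ n) ≡ toℚ (F p n)) →
    ∀ x → eval P (ι x) ≡ Fℤ p x
  eval≗Fℤ p P pos P≡F with degree-Fℤ p pos
  ... | d , deg = degree-agree (length P ℕ.+ d)
    (degree-≤ (ℕ.m≤m+n (length P) d) (degree-eval P)) (degree-≤ (ℕ.m≤n+m d (length P)) deg) P≡F

open Combinatorics using (Fcoarse; sum-F-coarsenings)
open Extension using (sign; Fneg; Fneg-zero; eval≗Fℤ; sumℚ-map-toℚ)
open import Data.Nat using (ℕ; zero; suc; _+_)
open import Data.Integer using (-[1+_])
open import Data.Rational using (_*_; -_)
open import Data.Empty using (⊥-elim)

mainTheorem4 : (p : List ℕ) → Positive p → p ≢ [] →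
    (P : Poly) → (∀ (n : ℕ) → eval P (toℚ n) ≡ toℚ (F p n)) →
    (L : List (List ℕ)) → Unique L → (∀ q → (q ∈ L) ⇔ (p ≺ q)) →
    ∀ (n : ℕ) →
      eval P (- toℚ n)
        ≡ negOnePow (sum p + length p) * sumℚ (map (λ q → toℚ (F q (suc n))) L)
mainTheorem4 []      _           []≢[] = ⊥-elim ([]≢[] refl)
mainTheorem4 (a ∷ p) (0<a ∷ pos) _ P P≡F L uniqueL L⇔≺ n = begin
  eval P (- toℚ n)
    ≡⟨ P-at-neg n ⟩
  sign (a ∷ p) * toℚ (Fcoarse (a ∷ p) (suc n))
    ≡⟨ cong (λ s → sign (a ∷ p) * toℚ s) (sum-F-coarsenings a p (suc n) pos uniqueL L⇔≺) ⟨
  sign (a ∷ p) * toℚ (sum (map (λ q → F q (suc n)) L))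
    ≡⟨ cong (sign (a ∷ p) *_) (sumℚ-map-toℚ (λ q → F q (suc n)) L) ⟨
  sign (a ∷ p) * sumℚ (map (λ q → toℚ (F q (suc n))) L)
    ∎
  where
  open ≡-Reasoning
  P-at-neg : ∀ n → eval P (- toℚ n) ≡ Fneg (a ∷ p) n
  P-at-neg zero    = trans (P≡F 0) (sym (Fneg-zero p 0<a))
  P-at-neg (suc m) = eval≗Fℤ (a ∷ p) P (0<a ∷ pos) P≡F -[1+ m ]
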